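{- Let $T$ be an $spo(2m,n)$-tableau and let $b \in B_0 \cup B_1$. Then the result $T \leftarrow b$ of $spo$-insertion of $b$ into $T$ is an $spo(2m,n)$-tableau.
   Context: Fix positive integers $m,n$. Let $B_0=\{1,\overline{1},2,\overline{2},\dots,m,\overline{m}\}$ and $B_1=\{1^\circ,\dots,n^\circ\}$, totally ordered by $1<\overline{1}<2<\overline{2}<\cdots<m<\overline{m}<1^\circ<2^\circ<\cdots<n^\circ$. Young diagrams are drawn with row $1$ on top and rows left-justified. An $spo(2m,n)$-tableau ($spo$-tableau) of shape $\lambda$ is a filling of the Young diagram of $\lambda$ with entries of $B_0\cup B_1$ such that: the boxes containing entries of $B_0$ form a Young diagram of some shape $\mu\subseteq\lambda$ (in the top-left corner), on which the entries are weakly increasing along rows, strictly increasing down columns, and satisfy the symplectic condition that every entry in row $i$ is $\geq i$ (i.e. row $i$ contains no $j$ or $\overline{j}$ with $j<i$); and the entries of $B_1$, filling the skew shape $\lambda/\mu$, are strictly increasing along rows from left to right and weakly increasing down columns. Forward slide (jeu de taquin): given a filling with one empty box, let $x$ be the entry immediately right of the empty box and $y$ the entry immediately below it. If only one of them exists, it moves into the empty box. If both exist: if $x<y$, or $x=y\in B_1$, then $x$ moves left into the empty box; if $y<x$, or $x=y\in B_0$, then $y$ moves up into the empty box. Forward slides are repeated until the empty box is at an outer corner (no box to its right and none below it), and then that box is deleted. $spo$-insertion $T\leftarrow x$ for $x\in B_0\cup B_1$: insert $z=x$ into row $1$. To insert $z$ into a row $r$: if $z\in B_0$ and $z$ is $\geq$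 every entry of row $r$, or $z\in B_1$ and $z$ is $>$ every entry of row $r$ (in particular if row $r$ is empty, i.e. below the bottom of the tableau), place $z$ in a new box at the end of row $r$ and stop. Otherwise, if $z\in B_1$ let $z'$ be the leftmost entry of row $r$ with $z'\geq z$, and if $z\in B_0$ let $z'$ be the leftmost entry of row $r$ with $z'>z$; replace $z'$ by $z$ and insert $z'$ into row $r+1$. However, if at some stage an entry $i\in\{1,\dots,m\}$ being inserted into row $i$ would bump an $\overline{i}$ out of row $i$ into row $i+1$ (a symplectic violation; a "cancellation"), then at the first (least $i$) such stage, instead of replacing $\overline{i}$ by $i$, the $\overline{i}$ is removed (and $i$ is not placed), leaving an empty box; forward slides are then applied to this empty box until it reaches an outer corner, where the box is deleted. In that case $T\leftarrow x$ has one fewer box than $T$; otherwise it has one more box. -}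

module Defs where

open import Data.Nat using (ℕ; zero; suc; _+_; _*_; _≤_; _<_; _<ᵇ_; _≤ᵇ_; _≡ᵇ_)
open import Data.Fin using (Fin; toℕ)
open import Data.Bool using (Bool; true; false; if_then_else_; _∧_)
open import Data.List using (List; []; _∷_; _++_; length; splitAt)
open import Data.Maybe using (Maybe; just; nothing)
open import Data.Product using (_×_; _,_)
open import Data.Sum using (_⊎_)
open import Data.Unit using (⊤)
open import Data.Empty using (⊥)
open import Relation.Binary.PropositionalEquality using (_≡_)

-- The alphabet B₀ ∪ B₁.
--   unb k  represents the unbarred letter  k+1      (k : Fin m)
--   bar k  represents the barred letter    \overline{k+1}
--   circ j represents (j+1)°                         (j : Fin n)

data Letter (m n : ℕ) : Set where
  unb  : Fin m → Letter m n
  bar  : Fin m → Letter m n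
  circ : Fin n → Letter m n

module _ {m n : ℕ} where

  -- position in the total order 1 < 1̄ < 2 < 2̄ < ... < m < m̄ < 1° < ... < n°
  rank : Letter m n → ℕ
  rank (unb k)  = 2 * toℕ k
  rank (bar k)  = suc (2 * toℕ k)
  rank (circ j) = 2 * m + toℕ j

  _≤L_ : Letter m n → Letter m n → Set
  a ≤L b = rank a ≤ rank b

  _<L_ : Letter m n → Letter m n → Set
  a <L b = rank a < rank b

  isB0 : Letter m n → Bool
  isB0 (unb _)  = true
  isB0 (bar _)  = true
  isB0 (circ _) = false

  IsB0 : Letter m n → Set
  IsB0 (unb _)  = ⊤
  IsB0 (bar _)  = ⊤
  IsB0 (circ _) = ⊥

  IsB1 : Letter m n → Set
  IsB1 (unb _)  = ⊥
  IsB1 (bar _)  = ⊥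
  IsB1 (circ _) = ⊤

  -- Fillings: a list of rows (row 1 first), each a list of letters
  -- (left to right).  Rows beyond the end of the list are empty.

  nth : {A : Set} → List A → ℕ → Maybe A
  nth []       _       = nothing
  nth (x ∷ xs) zero    = just x
  nth (x ∷ xs) (suc i) = nth xs i

  rowOf : List (List (Letter m n)) → ℕ → List (Letter m n)
  rowOf []       _       = []
  rowOf (r ∷ rs) zero    = r
  rowOf (r ∷ rs) (suc i) = rowOf rs i

  -- entry in row i, column j (both 0-indexed)
  entry : List (List (Letter m n)) → ℕ → ℕ → Maybe (Letter m n)
  entry T i j = nth (rowOf T i) j

  -- spo(2m,n)-tableau (rows/columns 0-indexed, so "row i" of the paper is i+1 here)
  record IsSpoTableau (T : List (List (Letter m n))) : Set where
    field
      shape   : ∀ i → length (rowOf T (suc i)) ≤ length (rowOf T i)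
      -- the B₀-boxes form a Young diagram μ ⊆ λ in the top-left corner
      -- (closed under moving left and moving up)
      b0-left : ∀ i j a b → entry T i j ≡ just a → entry T i (suc j) ≡ just b →
                IsB0 b → IsB0 a
      b0-up   : ∀ i j a b → entry T i j ≡ just a → entry T (suc i) j ≡ just b →
                IsB0 b → IsB0 a
      b0-row  : ∀ i j a b → entry T i j ≡ just a → entry T i (suc j) ≡ just b →
                IsB0 a → IsB0 b → a ≤L b
      b0-col  : ∀ i j a b → entry T i j ≡ just a → entry T (suc i) j ≡ just b →
                IsB0 a → IsB0 b → a <L b
      -- symplectic condition: row i+1 contains no k+1 or \overline{k+1} with k < i
      sympl   : ∀ i j (k : Fin m) → (entry T i j ≡ just (unb k) ⊎ entry T i j ≡ just (bar k)) →
                i ≤ toℕ k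
      b1-row  : ∀ i j a b → entry T i j ≡ just a → entry T i (suc j) ≡ just b →
                IsB1 a → IsB1 b → a <L b
      b1-col  : ∀ i j a b → entry T i j ≡ just a → entry T (suc i) j ≡ just b →
                IsB1 a → IsB1 b → a ≤L b

  -- The hole sits in the current row between `l` (entries
  -- to its left) and `r` (entries to its right); `below` are the rows
  -- underneath.  Returns the current row and all rows below after sliding
  -- the hole to an outer corner and deleting it.

  -- x (right neighbour) moves left iff x < y, or x = y ∈ B₁
  xMoves : Letter m n → Letter m n → Bool
  xMoves x y = if rank x <ᵇ rank y then true
               else ((rank x ≡ᵇ rank y) ∧ (if isB0 x then false else true))

  slide : List (Letter m n) → List (Letter m n) → List (List (Letter m n)) →
          List (List (Letter m n))
  -- no row below: every right neighbour moves left, last box deleted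
  slide l r []       = (l ++ r) ∷ []
  slide l r (b ∷ bs) = go l r
    where
    -- y = entry of b in the hole's column (if any)
    go : List (Letter m n) → List (Letter m n) → List (List (Letter m n))
    go l' r' with splitAt (length l') b | r'
    ... | bl , []       | []      = l' ∷ b ∷ bs
    ... | bl , []       | x ∷ r'' = go (l' ++ x ∷ []) r''
    ... | bl , (y ∷ br) | []      = (l' ++ y ∷ []) ∷ slide bl br bs
    ... | bl , (y ∷ br) | x ∷ r'' = if xMoves x y then go (l' ++ x ∷ []) r''
                                    else (l' ++ y ∷ x ∷ r'') ∷ slide bl br bs

  bumps : Letter m n → Letter m n → Bool
  bumps z a = if isB0 z then rank z <ᵇ rank a else rank z ≤ᵇ rank a

  findBump : Letter m n → List (Letter m n) →
             Maybe (List (Letter m n) × Letter m n × List (Letter m n))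
  findBump z []       = nothing
  findBump z (a ∷ as) with bumps z a | findBump z as
  ... | true  | _                      = just ([] , a , as)
  ... | false | nothing                = nothing
  ... | false | just (pre , z' , post) = just (a ∷ pre , z' , post)

  -- cancellation: the letter i = k+1 inserted into row i (0-indexed row r = k)
  -- would bump \overline{i}
  cancel : ℕ → Letter m n → Letter m n → Bool
  cancel r (unb k) (bar k') = (toℕ k ≡ᵇ r) ∧ (toℕ k' ≡ᵇ r)
  cancel r _       _        = false

  -- insert z into row r (0-indexed) and below; returns rows r, r+1, ...
  insRows : ℕ → Letter m n → List (List (Letter m n)) → List (List (Letter m n))
  insRows r z []            = (z ∷ []) ∷ []
  insRows r z (row ∷ rows) with findBump z row
  ... | nothing                = (row ++ z ∷ []) ∷ rows
  ... | just (pre , z' , post) =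
          if cancel r z z' then slide pre post rows
          else (pre ++ z ∷ post) ∷ insRows (suc r) z' rows

  spoInsert : List (List (Letter m n)) → Letter m n → List (List (Letter m n))
  spoInsert T x = insRows 0 x T

-- Recast the conditions row by row: each row is sorted for an
-- order ≤ʰ (weak on B₀, strict on B₁), each column for an order ≤ᵛ (strict
-- on B₀, weak on B₁), and row i contains only letters allowed there. The two
-- orders are dual (b ≤ʰ a iff not a ≤ᵛ b) and any mixed composite of them is
-- strict, which is all that bumping needs: the letter z′ bumped by z has
-- z ≤ᵛ z′, so the row stays sorted, the column conditions around the changed
-- boxes follow by composing the two orders, and z′ again fits into the next
-- row. A bumped letter stays allowed in the next row except when i bumps ī
-- out of row i, which is exactly the cancellation. Jeu de taquin chooses
-- between the right and the lower neighbour of the hole by ≤ᵛ, so each slide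
-- keeps rows sorted and columns increasing, also against the row above.

module Submission where

open import Defs
open import Data.Nat
open import Data.Nat.Properties
open import Data.Fin using (Fin; toℕ)
open import Data.Fin.Properties using (toℕ<n; toℕ-injective)
open import Data.Bool using (true; false)
open import Data.Unit using (⊤; tt)
open import Data.Empty using (⊥-elim)
open import Data.Maybe using (Maybe; just; nothing)
open import Data.Product using (_×_; _,_; proj₁; proj₂; map₁; uncurry)
open import Data.Sum using (_⊎_; inj₁; inj₂; [_,_]′)
open import Data.List using (List; []; _∷_; _++_; length; splitAt)
open import Data.List.Properties using (length-++; ++-assoc; ++-identityʳ)
open import Data.List.Relation.Unary.All as All using (All; []; _∷_)
open import Data.List.Relation.Unary.All.Properties using (++⁺)
open import Data.List.Relation.Unary.AllPairs using (AllPairs; []; _∷_)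
import Data.List.Relation.Unary.AllPairs.Properties as AllPairs
open import Data.List.Relation.Binary.Prefix.Heterogeneous using (Prefix; []; _∷_; _++ᵖ_)
import Data.List.Relation.Binary.Prefix.Heterogeneous.Properties as Prefix
open import Data.List.Relation.Binary.Prefix.Heterogeneous.Properties
  using (length-mono; fromPointwise)
open import Data.List.Relation.Binary.Pointwise as Pointwise using (Pointwise; []; _∷_)
open import Data.List.Relation.Unary.Linked using (Linked; []; [-]; _∷_)
open import Data.List.Relation.Unary.Linked.Properties using (AllPairs⇒Linked; Linked⇒AllPairs)
open import Function using (_∘_; flip)
open import Relation.Binary.Core using (Rel)
open import Relation.Binary.PropositionalEquality
open import Relation.Nullary using (¬_; contradiction)
open import Relation.Nullary.Reflects using (Reflects; ofʸ; ofⁿ; fromEquivalence)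

module _ {a p} {A : Set a} {P : A → Set p} where

  All-middle : ∀ l {x r} → All P (l ++ x ∷ r) → P x × All P (l ++ r)
  All-middle []      (px ∷ pr) = px , pr
  All-middle (_ ∷ l) (pc ∷ pl) with All-middle l pl
  ... | px , plr = px , pc ∷ plr

  All-insert : ∀ l {x r} → P x → All P (l ++ r) → All P (l ++ x ∷ r)
  All-insert []      px plr        = px ∷ plr
  All-insert (_ ∷ l) px (pc ∷ plr) = pc ∷ All-insert l px plr

module _ {a ℓ} {A : Set a} {R : Rel A ℓ} where

  AllPairs-middle : ∀ l {x r} → AllPairs R (l ++ x ∷ r) →
                    All (λ c → R c x) l × All (R x) r × AllPairs R (l ++ r)
  AllPairs-middle []      (Rx ∷ Rr) = [] , Rx , Rr
  AllPairs-middle (_ ∷ l) (Rc ∷ Rl) with All-middle l Rc | AllPairs-middle l Rl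
  ... | Rcx , Rclr | Rlx , Rxr , Rlr = Rcx ∷ Rlx , Rxr , Rclr ∷ Rlr

  AllPairs-insert : ∀ l {x r} → All (λ c → R c x) l → All (R x) r →
                    AllPairs R (l ++ r) → AllPairs R (l ++ x ∷ r)
  AllPairs-insert []      []          Rxr Rr          = Rxr ∷ Rr
  AllPairs-insert (_ ∷ l) (Rcx ∷ Rlx) Rxr (Rclr ∷ Rlr) =
    All-insert l Rcx Rclr ∷ AllPairs-insert l Rlx Rxr Rlr

  AllPairs-++⁻ʳ : ∀ l {r} → AllPairs R (l ++ r) → AllPairs R r
  AllPairs-++⁻ʳ []      Rr       = Rr
  AllPairs-++⁻ʳ (_ ∷ l) (_ ∷ Rl) = AllPairs-++⁻ʳ l Rl

module _ {a} {A : Set a} where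

  splitAt-++ : ∀ k (xs : List A) {ys zs} → splitAt k xs ≡ (ys , zs) → ys ++ zs ≡ xs
  splitAt-++ zero    xs       refl = refl
  splitAt-++ (suc k) []       refl = refl
  splitAt-++ (suc k) (x ∷ xs) eq with splitAt k xs in eq′
  ... | _ , _ with refl ← eq = cong (x ∷_) (splitAt-++ k xs eq′)

  splitAt-suc-[] : ∀ k (xs : List A) {ys} → splitAt k xs ≡ (ys , []) →
                   splitAt (suc k) xs ≡ (ys , [])
  splitAt-suc-[] zero    []       refl = refl
  splitAt-suc-[] (suc k) []       refl = refl
  splitAt-suc-[] (suc k) (x ∷ xs) eq with splitAt k xs in eq′
  ... | _ , _ with refl ← eq = cong (map₁ (x ∷_)) (splitAt-suc-[] k xs eq′)

  splitAt-suc-∷ : ∀ k (xs : List A) {ys y zs} → splitAt k xs ≡ (ys , y ∷ zs) →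
                  splitAt (suc k) xs ≡ (ys ++ y ∷ [] , zs)
  splitAt-suc-∷ zero    (_ ∷ _)  refl = refl
  splitAt-suc-∷ (suc k) []       ()
  splitAt-suc-∷ (suc k) (x ∷ xs) eq with splitAt k xs in eq′
  ... | _ , _ with refl ← eq = cong (map₁ (x ∷_)) (splitAt-suc-∷ k xs eq′)

  subst-∷-++ : ∀ {p} (P : List A → Set p) l {x r} → P (l ++ x ∷ r) → P ((l ++ x ∷ []) ++ r)
  subst-∷-++ P l {x} {r} = subst P (sym (++-assoc l (x ∷ []) r))

  length-∷ʳ : ∀ (xs : List A) {x} → length (xs ++ x ∷ []) ≡ suc (length xs)
  length-∷ʳ xs = trans (length-++ xs) (+-comm (length xs) 1)

≡ᵇ-refl : ∀ i → (i ≡ᵇ i) ≡ true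
≡ᵇ-refl zero    = refl
≡ᵇ-refl (suc i) = ≡ᵇ-refl i

≡ᵇ-reflects-≡ : ∀ i j → Reflects (i ≡ j) (i ≡ᵇ j)
≡ᵇ-reflects-≡ i j = fromEquivalence (≡ᵇ⇒≡ i j) (≡⇒≡ᵇ i j)

module _ {m n : ℕ} where

  _≤ʰ_ : Letter m n → Letter m n → Set
  unb k  ≤ʰ b = unb k ≤L b
  bar k  ≤ʰ b = bar k ≤L b
  circ j ≤ʰ b = circ j <L b

  _≤ᵛ_ : Letter m n → Letter m n → Set
  unb k  ≤ᵛ b = unb k <L b
  bar k  ≤ᵛ b = bar k <L b
  circ j ≤ᵛ b = circ j ≤L b

  B₀<B₁ : ∀ {a : Letter m n} (j : Fin n) → IsB0 a → a <L circ j
  B₀<B₁ {unb k} j _ = ≤-<-trans (n≤1+n _) (B₀<B₁ {bar k} j tt)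
  B₀<B₁ {bar k} j _ = begin
    suc (suc (2 * toℕ k)) ≡⟨ *-suc 2 (toℕ k) ⟨
    2 * suc (toℕ k)       ≤⟨ *-monoʳ-≤ 2 (toℕ<n k) ⟩
    2 * m                 ≤⟨ m≤m+n (2 * m) (toℕ j) ⟩
    2 * m + toℕ j         ∎
    where open ≤-Reasoning

  private variable a b c : Letter m n

  ≤ʰ⇒≤L : a ≤ʰ b → a ≤L b
  ≤ʰ⇒≤L {a = unb _}  p = p
  ≤ʰ⇒≤L {a = bar _}  p = p
  ≤ʰ⇒≤L {a = circ _} p = <⇒≤ p

  ≤ᵛ⇒≤L : a ≤ᵛ b → a ≤L b
  ≤ᵛ⇒≤L {a = unb _}  p = <⇒≤ p
  ≤ᵛ⇒≤L {a = bar _}  p = <⇒≤ p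
  ≤ᵛ⇒≤L {a = circ _} p = p

  <L⇒≤ʰ : a <L b → a ≤ʰ b
  <L⇒≤ʰ {a = unb _}  p = <⇒≤ p
  <L⇒≤ʰ {a = bar _}  p = <⇒≤ p
  <L⇒≤ʰ {a = circ _} p = p

  <L⇒≤ᵛ : a <L b → a ≤ᵛ b
  <L⇒≤ᵛ {a = unb _}  p = p
  <L⇒≤ᵛ {a = bar _}  p = p
  <L⇒≤ᵛ {a = circ _} p = <⇒≤ p

  ≤ʰ-≤ᵛ-<L : a ≤ʰ b → b ≤ᵛ c → a <L c
  ≤ʰ-≤ᵛ-<L {a = circ _}                p q = <-≤-trans p (≤ᵛ⇒≤L q)
  ≤ʰ-≤ᵛ-<L {a = unb _}  {b = unb _}    p q = ≤-<-trans p q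
  ≤ʰ-≤ᵛ-<L {a = unb _}  {b = bar _}    p q = ≤-<-trans p q
  ≤ʰ-≤ᵛ-<L {a = unb k}  {b = circ j}   _ q = <-≤-trans (B₀<B₁ {unb k} j tt) q
  ≤ʰ-≤ᵛ-<L {a = bar _}  {b = unb _}    p q = ≤-<-trans p q
  ≤ʰ-≤ᵛ-<L {a = bar _}  {b = bar _}    p q = ≤-<-trans p q
  ≤ʰ-≤ᵛ-<L {a = bar k}  {b = circ j}   _ q = <-≤-trans (B₀<B₁ {bar k} j tt) q

  ≤ᵛ-≤ʰ-<L : a ≤ᵛ b → b ≤ʰ c → a <L c
  ≤ᵛ-≤ʰ-<L {a = unb _}                 p q = <-≤-trans p (≤ʰ⇒≤L q)
  ≤ᵛ-≤ʰ-<L {a = bar _}                 p q = <-≤-trans p (≤ʰ⇒≤L q)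
  ≤ᵛ-≤ʰ-<L {a = circ _} {b = circ _}   p q = ≤-<-trans p q
  ≤ᵛ-≤ʰ-<L {a = circ j} {b = unb k}    p _ = contradiction p (<⇒≱ (B₀<B₁ {unb k} j tt))
  ≤ᵛ-≤ʰ-<L {a = circ j} {b = bar k}    p _ = contradiction p (<⇒≱ (B₀<B₁ {bar k} j tt))

  ≤ʰ-trans : a ≤ʰ b → b ≤ʰ c → a ≤ʰ c
  ≤ʰ-trans {a = unb _}  p q = ≤-trans p (≤ʰ⇒≤L q)
  ≤ʰ-trans {a = bar _}  p q = ≤-trans p (≤ʰ⇒≤L q)
  ≤ʰ-trans {a = circ _} p q = <-≤-trans p (≤ʰ⇒≤L q)

  ≤ᵛ-trans : a ≤ᵛ b → b ≤ᵛ c → a ≤ᵛ c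
  ≤ᵛ-trans {a = unb _}  p q = <-≤-trans p (≤ᵛ⇒≤L q)
  ≤ᵛ-trans {a = bar _}  p q = <-≤-trans p (≤ᵛ⇒≤L q)
  ≤ᵛ-trans {a = circ _} p q = ≤-trans p (≤ᵛ⇒≤L q)

  ≤ʰ-≤ᵛ⇒≤ᵛ : a ≤ʰ b → b ≤ᵛ c → a ≤ᵛ c
  ≤ʰ-≤ᵛ⇒≤ᵛ p q = <L⇒≤ᵛ (≤ʰ-≤ᵛ-<L p q)

  ≤ᵛ-≤ʰ⇒≤ʰ : a ≤ᵛ b → b ≤ʰ c → a ≤ʰ c
  ≤ᵛ-≤ʰ⇒≤ʰ p q = <L⇒≤ʰ (≤ᵛ-≤ʰ-<L p q)

  ≤ᵛ⇒≱ʰ : a ≤ᵛ b → ¬ b ≤ʰ a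
  ≤ᵛ⇒≱ʰ p q = <-irrefl refl (≤ᵛ-≤ʰ-<L p q)

  ≰ᵛ⇒≥ʰ : ¬ a ≤ᵛ b → b ≤ʰ a
  ≰ᵛ⇒≥ʰ {a = circ _}               p = <L⇒≤ʰ (≰⇒> p)
  ≰ᵛ⇒≥ʰ {a = unb _}  {b = unb _}  p = ≮⇒≥ p
  ≰ᵛ⇒≥ʰ {a = unb _}  {b = bar _}  p = ≮⇒≥ p
  ≰ᵛ⇒≥ʰ {a = unb k}  {b = circ j} p = contradiction (B₀<B₁ {unb k} j tt) p
  ≰ᵛ⇒≥ʰ {a = bar _}  {b = unb _}  p = ≮⇒≥ p
  ≰ᵛ⇒≥ʰ {a = bar _}  {b = bar _}  p = ≮⇒≥ p
  ≰ᵛ⇒≥ʰ {a = bar k}  {b = circ j} p = contradiction (B₀<B₁ {bar k} j tt) p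

  ≤L-IsB0 : a ≤L b → IsB0 b → IsB0 a
  ≤L-IsB0 {a = unb _}                 _ _ = tt
  ≤L-IsB0 {a = bar _}                 _ _ = tt
  ≤L-IsB0 {a = circ j} {b = unb k}    p _ = contradiction p (<⇒≱ (B₀<B₁ {unb k} j tt))
  ≤L-IsB0 {a = circ j} {b = bar k}    p _ = contradiction p (<⇒≱ (B₀<B₁ {bar k} j tt))

  ≤ʰ-intro : (IsB0 b → IsB0 a) → (IsB0 a → IsB0 b → a ≤L b) → (IsB1 a → IsB1 b → a <L b) → a ≤ʰ b
  ≤ʰ-intro {b = unb _}  {a = unb _}  _ p _ = p tt tt
  ≤ʰ-intro {b = unb _}  {a = bar _}  _ p _ = p tt tt
  ≤ʰ-intro {b = unb _}  {a = circ _} q _ _ = ⊥-elim (q tt)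
  ≤ʰ-intro {b = bar _}  {a = unb _}  _ p _ = p tt tt
  ≤ʰ-intro {b = bar _}  {a = bar _}  _ p _ = p tt tt
  ≤ʰ-intro {b = bar _}  {a = circ _} q _ _ = ⊥-elim (q tt)
  ≤ʰ-intro {b = circ j} {a = unb k}  _ _ _ = <⇒≤ (B₀<B₁ {unb k} j tt)
  ≤ʰ-intro {b = circ j} {a = bar k}  _ _ _ = <⇒≤ (B₀<B₁ {bar k} j tt)
  ≤ʰ-intro {b = circ _} {a = circ _} _ _ p = p tt tt

  ≤ᵛ-intro : (IsB0 b → IsB0 a) → (IsB0 a → IsB0 b → a <L b) → (IsB1 a → IsB1 b → a ≤L b) → a ≤ᵛ b
  ≤ᵛ-intro {b = unb _}  {a = unb _}  _ p _ = p tt tt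
  ≤ᵛ-intro {b = unb _}  {a = bar _}  _ p _ = p tt tt
  ≤ᵛ-intro {b = unb _}  {a = circ _} q _ _ = ⊥-elim (q tt)
  ≤ᵛ-intro {b = bar _}  {a = unb _}  _ p _ = p tt tt
  ≤ᵛ-intro {b = bar _}  {a = bar _}  _ p _ = p tt tt
  ≤ᵛ-intro {b = bar _}  {a = circ _} q _ _ = ⊥-elim (q tt)
  ≤ᵛ-intro {b = circ j} {a = unb k}  _ _ _ = B₀<B₁ {unb k} j tt
  ≤ᵛ-intro {b = circ j} {a = bar k}  _ _ _ = B₀<B₁ {bar k} j tt
  ≤ᵛ-intro {b = circ _} {a = circ _} _ _ p = p tt tt

  ≤ʰ-IsB1 : a ≤ʰ b → IsB1 a → IsB1 b → a <L b
  ≤ʰ-IsB1 {a = circ _} p _ _ = p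

  ≤ᵛ-IsB0 : a ≤ᵛ b → IsB0 a → IsB0 b → a <L b
  ≤ᵛ-IsB0 {a = unb _} p _ _ = p
  ≤ᵛ-IsB0 {a = bar _} p _ _ = p

  ≤ᵛ-IsB1 : a ≤ᵛ b → IsB1 a → IsB1 b → a ≤L b
  ≤ᵛ-IsB1 {a = circ _} p _ _ = p

  bumps-reflects : ∀ z a → Reflects (z ≤ᵛ a) (bumps z a)
  bumps-reflects (unb _)  _ = <ᵇ-reflects-< _ _
  bumps-reflects (bar _)  _ = <ᵇ-reflects-< _ _
  bumps-reflects (circ _) _ = ≤ᵇ-reflects-≤ _ _

  xMoves-reflects : ∀ x y → Reflects (x ≤ᵛ y) (xMoves x y)
  xMoves-reflects x y with rank x <ᵇ rank y | <ᵇ-reflects-< (rank x) (rank y)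
  ... | true  | ofʸ x<y = ofʸ (<L⇒≤ᵛ x<y)
  ... | false | ofⁿ x≮y with rank x ≡ᵇ rank y | ≡ᵇ-reflects-≡ (rank x) (rank y)
  ...   | false | ofⁿ x≢y =
    ofⁿ λ x≤ᵛy → [ x≮y , x≢y ]′ (m≤n⇒m<n∨m≡n (≤ᵛ⇒≤L x≤ᵛy))
  xMoves-reflects (unb _)  _ | false | ofⁿ x≮y | true | _       = ofⁿ x≮y
  xMoves-reflects (bar _)  _ | false | ofⁿ x≮y | true | _       = ofⁿ x≮y
  xMoves-reflects (circ _) _ | false | _       | true | ofʸ x≡y = ofʸ (≤-reflexive x≡y)

  -- `Symplectic i a`: the letter a may occur in row i (counted from 0).
  Symplectic : ℕ → Letter m n → Set
  Symplectic i (unb k)  = i ≤ toℕ k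
  Symplectic i (bar k)  = i ≤ toℕ k
  Symplectic i (circ _) = ⊤

  Symplectic-zero : ∀ a → Symplectic 0 a
  Symplectic-zero (unb _)  = z≤n
  Symplectic-zero (bar _)  = z≤n
  Symplectic-zero (circ _) = tt

  Symplectic-pred : ∀ {i} a → Symplectic (suc i) a → Symplectic i a
  Symplectic-pred (unb _)  p = <⇒≤ p
  Symplectic-pred (bar _)  p = <⇒≤ p
  Symplectic-pred (circ _) p = tt

  bumped-symplectic : ∀ {i} z z′ → Symplectic i z → z ≤ᵛ z′ → cancel i z z′ ≡ false →
                      Symplectic (suc i) z′
  bumped-symplectic z        (circ _) _ _ _ = tt
  bumped-symplectic (circ j) (unb k)  _ p _ = contradiction p (<⇒≱ (B₀<B₁ {unb k} j tt))
  bumped-symplectic (circ j) (bar k)  _ p _ = contradiction p (<⇒≱ (B₀<B₁ {bar k} j tt))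
  bumped-symplectic (unb j)  (unb k)  s p _ = ≤-<-trans s (*-cancelˡ-< 2 _ _ p)
  bumped-symplectic (bar j)  (unb k)  s p _ = ≤-<-trans s (*-cancelˡ-< 2 _ _ (<-trans (n<1+n _) p))
  bumped-symplectic (bar j)  (bar k)  s p _ = ≤-<-trans s (*-cancelˡ-< 2 _ _ (≤-pred p))
  bumped-symplectic {i} (unb j) (bar k) s p e
    with m≤n⇒m<n∨m≡n (*-cancelˡ-≤ 2 (≤-pred p))
  ... | inj₁ j<k = ≤-<-trans s j<k
  ... | inj₂ j≡k with toℕ-injective j≡k
  ...   | refl with m≤n⇒m<n∨m≡n s
  ...     | inj₁ i<j  = i<j
  ...     | inj₂ refl rewrite ≡ᵇ-refl i with e
  ...       | ()

  Row : Set
  Row = List (Letter m n)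

  _≥ᵛ_ : Letter m n → Letter m n → Set
  _≥ᵛ_ = flip _≤ᵛ_

  -- `Above u w`: the row w can stand directly below the row u.
  Above : Row → Row → Set
  Above u w = Prefix _≥ᵛ_ w u

  AboveHead : Row → List Row → Set
  AboveHead u []      = ⊤
  AboveHead u (w ∷ _) = Above u w

  -- `Tableau i ws`: the rows ws, the first of them placed as row i, form
  -- an spo-tableau.
  data Tableau (i : ℕ) : List Row → Set where
    []  : Tableau i []
    row : ∀ {w ws} → AllPairs _≤ʰ_ w → All (Symplectic i) w → AboveHead w ws →
          Tableau (suc i) ws → Tableau i (w ∷ ws)

  Linked-nth⁺ : ∀ {ℓ} {R : Rel (Letter m n) ℓ} w →
                (∀ j {a b} → nth {m} {n} w j ≡ just a → nth {m} {n} w (suc j) ≡ just b → R a b) →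
                Linked R w
  Linked-nth⁺ []          _ = []
  Linked-nth⁺ (_ ∷ [])    _ = [-]
  Linked-nth⁺ (_ ∷ b ∷ w) R-nth = R-nth 0 refl refl ∷ Linked-nth⁺ (b ∷ w) (R-nth ∘ suc)

  Linked-nth⁻ : ∀ {ℓ} {R : Rel (Letter m n) ℓ} {w} → Linked R w →
                ∀ j {a b} → nth {m} {n} w j ≡ just a → nth {m} {n} w (suc j) ≡ just b → R a b
  Linked-nth⁻ (Rab ∷ _)  zero    refl refl = Rab
  Linked-nth⁻ [-]        zero    _    ()
  Linked-nth⁻ [-]        (suc j) ()
  Linked-nth⁻ (_ ∷ Rw)   (suc j) = Linked-nth⁻ Rw j

  All-nth⁺ : ∀ {ℓ} {P : Letter m n → Set ℓ} w → (∀ j {a} → nth {m} {n} w j ≡ just a → P a) → All P w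
  All-nth⁺ []      _     = []
  All-nth⁺ (_ ∷ w) P-nth = P-nth 0 refl ∷ All-nth⁺ w (P-nth ∘ suc)

  All-nth⁻ : ∀ {ℓ} {P : Letter m n → Set ℓ} {w} → All P w → ∀ j {a} → nth {m} {n} w j ≡ just a → P a
  All-nth⁻ (Pa ∷ _)  zero    refl = Pa
  All-nth⁻ (_  ∷ Pw) (suc j) = All-nth⁻ Pw j

  Above-nth⁺ : ∀ u w → length w ≤ length u →
               (∀ j {a b} → nth {m} {n} u j ≡ just a → nth {m} {n} w j ≡ just b → a ≤ᵛ b) → Above u w
  Above-nth⁺ _       []      _         _     = []
  Above-nth⁺ (_ ∷ u) (_ ∷ w) (s≤s w≤u) ≤ᵛ-nth =
    ≤ᵛ-nth 0 refl refl ∷ Above-nth⁺ u w w≤u (≤ᵛ-nth ∘ suc)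

  Above-nth⁻ : ∀ {u w} → Above u w →
               ∀ j {a b} → nth {m} {n} u j ≡ just a → nth {m} {n} w j ≡ just b → a ≤ᵛ b
  Above-nth⁻ (p ∷ _)  zero    refl refl = p
  Above-nth⁻ (_ ∷ ps) (suc j) = Above-nth⁻ ps j

  -- The conditions of IsSpoTableau, with rows counted from i.
  record EntryWise (i : ℕ) (T : List Row) : Set where
    field
      shape      : ∀ r → length (rowOf T (suc r)) ≤ length (rowOf T r)
      row-≤ʰ     : ∀ r j {a b} → entry T r j ≡ just a → entry T r (suc j) ≡ just b → a ≤ʰ b
      col-≤ᵛ     : ∀ r j {a b} → entry T r j ≡ just a → entry T (suc r) j ≡ just b → a ≤ᵛ b
      symplectic : ∀ r j {a} → entry T r j ≡ just a → Symplectic (r + i) a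
  open EntryWise

  EntryWise-tail : ∀ {i w ws} → EntryWise i (w ∷ ws) → EntryWise (suc i) ws
  EntryWise-tail {i} E = record
    { shape      = shape E ∘ suc
    ; row-≤ʰ     = row-≤ʰ E ∘ suc
    ; col-≤ᵛ     = col-≤ᵛ E ∘ suc
    ; symplectic = λ r j {a} e →
        subst (λ k → Symplectic k a) (sym (+-suc r i)) (symplectic E (suc r) j e)
    }

  EntryWise⇒Tableau : ∀ {i} T → EntryWise i T → Tableau i T
  EntryWise⇒Tableau []       _ = []
  EntryWise⇒Tableau (w ∷ ws) E =
    row (Linked⇒AllPairs ≤ʰ-trans (Linked-nth⁺ w (row-≤ʰ E 0)))
        (All-nth⁺ w (symplectic E 0))
        (aboveHead ws (shape E 0) (col-≤ᵛ E 0))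
        (EntryWise⇒Tableau ws (EntryWise-tail E))
    where
    aboveHead : ∀ ws → length (rowOf ws 0) ≤ length w →
                (∀ j {a b} → nth {m} {n} w j ≡ just a → entry ws 0 j ≡ just b → a ≤ᵛ b) →
                AboveHead w ws
    aboveHead []      _ _ = tt
    aboveHead (v ∷ _) = Above-nth⁺ w v

  Tableau⇒EntryWise : ∀ {i T} → Tableau i T → EntryWise i T
  Tableau⇒EntryWise [] = record
    { shape = λ _ → z≤n ; row-≤ʰ = λ _ _ () ; col-≤ᵛ = λ _ _ () ; symplectic = λ _ _ () }
  Tableau⇒EntryWise {i} {w ∷ ws} (row w-sorted w-sympl w-above ws-tableau) = record
    { shape      = λ { zero → shapeHead ws w-above ; (suc r) → shape E r }
    ; row-≤ʰ     = λ { zero → Linked-nth⁻ (AllPairs⇒Linked w-sorted) ; (suc r) → row-≤ʰ E r }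
    ; col-≤ᵛ     = λ { zero → colHead ws w-above ; (suc r) → col-≤ᵛ E r }
    ; symplectic = λ { zero → All-nth⁻ w-sympl
                     ; (suc r) j {a} e →
                         subst (λ k → Symplectic k a) (+-suc r i) (symplectic E r j e) }
    }
    where
    E = Tableau⇒EntryWise ws-tableau
    shapeHead : ∀ ws → AboveHead w ws → length (rowOf ws 0) ≤ length w
    shapeHead []      _ = z≤n
    shapeHead (_ ∷ _) = length-mono
    colHead : ∀ ws → AboveHead w ws →
              ∀ j {a b} → nth {m} {n} w j ≡ just a → entry ws 0 j ≡ just b → a ≤ᵛ b
    colHead []      _ _ _ ()
    colHead (_ ∷ _) = Above-nth⁻

  IsSpoTableau⇒EntryWise : ∀ {T} → IsSpoTableau T → EntryWise 0 T
  IsSpoTableau⇒EntryWise {T} t = record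
    { shape      = IsSpoTableau.shape t
    ; row-≤ʰ     = λ r j e e′ →
        ≤ʰ-intro (b0-left r j _ _ e e′) (b0-row r j _ _ e e′) (b1-row r j _ _ e e′)
    ; col-≤ᵛ     = λ r j e e′ →
        ≤ᵛ-intro (b0-up r j _ _ e e′) (b0-col r j _ _ e e′) (b1-col r j _ _ e e′)
    ; symplectic = λ r j {a} e → subst (λ k → Symplectic k a) (sym (+-identityʳ r)) (sympl′ r j a e)
    }
    where
    open IsSpoTableau t hiding (shape)
    sympl′ : ∀ r j a → entry T r j ≡ just a → Symplectic r a
    sympl′ r j (unb k)  e = sympl r j k (inj₁ e)
    sympl′ r j (bar k)  e = sympl r j k (inj₂ e)
    sympl′ r j (circ _) _ = tt

  EntryWise⇒IsSpoTableau : ∀ {T} → EntryWise 0 T → IsSpoTableau T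
  EntryWise⇒IsSpoTableau {T} E = record
    { shape   = shape E
    ; b0-left = λ r j _ _ e e′ → ≤L-IsB0 (≤ʰ⇒≤L (row-≤ʰ E r j e e′))
    ; b0-up   = λ r j _ _ e e′ → ≤L-IsB0 (≤ᵛ⇒≤L (col-≤ᵛ E r j e e′))
    ; b0-row  = λ r j _ _ e e′ _ _ → ≤ʰ⇒≤L (row-≤ʰ E r j e e′)
    ; b0-col  = λ r j _ _ e e′ → ≤ᵛ-IsB0 (col-≤ᵛ E r j e e′)
    ; sympl   = sympl′
    ; b1-row  = λ r j _ _ e e′ → ≤ʰ-IsB1 (row-≤ʰ E r j e e′)
    ; b1-col  = λ r j _ _ e e′ → ≤ᵛ-IsB1 (col-≤ᵛ E r j e e′)
    }
    where
    sympl′ : ∀ r j k → entry T r j ≡ just (unb k) ⊎ entry T r j ≡ just (bar k) → r ≤ toℕ k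
    sympl′ r j k (inj₁ e) = subst (_≤ toℕ k) (+-identityʳ r) (symplectic E r j e)
    sympl′ r j k (inj₂ e) = subst (_≤ toℕ k) (+-identityʳ r) (symplectic E r j e)

  IsSpoTableau⇒Tableau : ∀ {T} → IsSpoTableau T → Tableau 0 T
  IsSpoTableau⇒Tableau t = EntryWise⇒Tableau _ (IsSpoTableau⇒EntryWise t)

  Tableau⇒IsSpoTableau : ∀ {T} → Tableau 0 T → IsSpoTableau T
  Tableau⇒IsSpoTableau t = EntryWise⇒IsSpoTableau (Tableau⇒EntryWise t)

  Above-shift : ∀ {u U r} → All (u ≤ʰ_) U → AllPairs _≤ʰ_ U → Above U r → Above (u ∷ U) r
  Above-shift _              _            []       = []
  Above-shift (u≤u′ ∷ _) (u′≤U ∷ U-sorted) (p ∷ ps) = ≤ʰ-≤ᵛ⇒≤ᵛ u≤u′ p ∷ Above-shift u′≤U U-sorted ps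

  Above-lower : ∀ l {z z₀ r w} → z₀ ≤ᵛ z → Above (l ++ z ∷ r) w → Above (l ++ z₀ ∷ r) w
  Above-lower []      _    []       = []
  Above-lower []      z₀≤z (p ∷ ps) = ≤ᵛ-trans z₀≤z p ∷ ps
  Above-lower (_ ∷ _) _    []       = []
  Above-lower (_ ∷ l) z₀≤z (p ∷ ps) = p ∷ Above-lower l z₀≤z ps

  Pointwise-All-≤ʰ : ∀ {l w y} → Pointwise _≥ᵛ_ w l → All (_≤ʰ y) w → All (_≤ʰ y) l
  Pointwise-All-≤ʰ []       []         = []
  Pointwise-All-≤ʰ (p ∷ ps) (q ∷ qs) = ≤ᵛ-≤ʰ⇒≤ʰ p q ∷ Pointwise-All-≤ʰ ps qs

  -- The letter z, bumped out of the upper row (where z₀ replaces it), is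
  -- appended to the lower row w, or replaces z′ in it.
  Above-bump-append : ∀ l {z z₀ r} w → Above (l ++ z ∷ r) w → All (_≤ʰ z) w →
                      All (_≤ʰ z₀) l → z₀ ≤ᵛ z → Above (l ++ z₀ ∷ r) (w ++ z ∷ [])
  Above-bump-append []      []      _        _          _          z₀≤z = z₀≤z ∷ []
  Above-bump-append []      (_ ∷ _) (p ∷ _)  (q ∷ _)    _          _    = contradiction q (≤ᵛ⇒≱ʰ p)
  Above-bump-append (_ ∷ _) []      _        _          (a≤z₀ ∷ _) z₀≤z = ≤ʰ-≤ᵛ⇒≤ᵛ a≤z₀ z₀≤z ∷ []
  Above-bump-append (_ ∷ l) (_ ∷ w) (p ∷ ps) (_ ∷ w≤z) (_ ∷ l≤z₀) z₀≤z =
    p ∷ Above-bump-append l w ps w≤z l≤z₀ z₀≤z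

  Above-bump-replace : ∀ l {z z₀ z′ r} pre {post} → Above (l ++ z ∷ r) (pre ++ z′ ∷ post) →
                       All (_≤ʰ z) pre → z ≤ᵛ z′ → All (_≤ʰ z₀) l → z₀ ≤ᵛ z →
                       Above (l ++ z₀ ∷ r) (pre ++ z ∷ post)
  Above-bump-replace []      []      (_ ∷ ps) _           _    _          z₀≤z = z₀≤z ∷ ps
  Above-bump-replace []      (_ ∷ _) (p ∷ _)  (q ∷ _)     _    _          _    = contradiction q (≤ᵛ⇒≱ʰ p)
  Above-bump-replace (_ ∷ l) []      (_ ∷ ps) _           _    (a≤z₀ ∷ _) z₀≤z =
    ≤ʰ-≤ᵛ⇒≤ᵛ a≤z₀ z₀≤z ∷ Above-lower l z₀≤z ps
  Above-bump-replace (_ ∷ l) (_ ∷ pre) (p ∷ ps) (_ ∷ pre≤z) z≤z′ (_ ∷ l≤z₀) z₀≤z =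
    p ∷ Above-bump-replace l pre ps pre≤z z≤z′ l≤z₀ z₀≤z

  data BumpView (z : Letter m n) : Row → Maybe (Row × Letter m n × Row) → Set where
    append : ∀ {w} → All (_≤ʰ z) w → BumpView z w nothing
    bump   : ∀ pre z′ post → All (_≤ʰ z) pre → z ≤ᵛ z′ →
             BumpView z (pre ++ z′ ∷ post) (just (pre , z′ , post))

  bumpView : ∀ z w → BumpView z w (findBump z w)
  bumpView z []      = append []
  bumpView z (a ∷ w) with bumps z a | bumps-reflects z a | findBump z w | bumpView z w
  ... | true  | ofʸ z≤a | _       | _                       = bump [] a w [] z≤a
  ... | false | ofⁿ z≰a | nothing | append w≤z             = append (≰ᵛ⇒≥ʰ z≰a ∷ w≤z)
  ... | false | ofⁿ z≰a | just _  | bump pre z′ post pre≤z z≤z′ =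
    bump (a ∷ pre) z′ post (≰ᵛ⇒≥ʰ z≰a ∷ pre≤z) z≤z′

  -- The row below the row l □ r, which has a hole at column |l|, split at
  -- that column: its left part lies under l and its right part, apart from
  -- the entry under the hole, under r.
  HoleAboveSplit : Row → Row → Row × Row → Set
  HoleAboveSplit l r (bl , [])     = Above l bl
  HoleAboveSplit l r (bl , _ ∷ br) = Pointwise _≥ᵛ_ bl l × Above r br

  HoleAbove : Row → Row → List Row → Set
  HoleAbove l r []      = ⊤
  HoleAbove l r (b ∷ _) = HoleAboveSplit l r (splitAt (length l) b)

  ≤ᵛ-head : Letter m n → Row → Set
  ≤ᵛ-head u []      = ⊤
  ≤ᵛ-head u (y ∷ _) = u ≤ᵛ y

  -- u lies above the entry (if any) under the hole at column |l|.
  AboveHole : Letter m n → Row → List Row → Set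
  AboveHole u l []      = ⊤
  AboveHole u l (b ∷ _) = ≤ᵛ-head u (proj₂ (splitAt (length l) b))

  AboveHole-≤ᵛ : ∀ {u a} l bs → u ≤ᵛ a → AboveHole a l bs → AboveHole u l bs
  AboveHole-≤ᵛ l []      _   _ = tt
  AboveHole-≤ᵛ l (b ∷ _) u≤a p with proj₂ (splitAt (length l) b)
  ... | []    = tt
  ... | _ ∷ _ = ≤ᵛ-trans u≤a p

  Above-hole : ∀ l {a r} b → Above (l ++ a ∷ r) b →
               HoleAboveSplit l r (splitAt (length l) b) × ≤ᵛ-head a (proj₂ (splitAt (length l) b))
  Above-hole []      []      []       = [] , tt
  Above-hole []      (_ ∷ _) (p ∷ ps) = ([] , ps) , p
  Above-hole (_ ∷ _) []      []       = [] , tt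
  Above-hole (_ ∷ l) (y ∷ b) (p ∷ ps) with splitAt (length l) b | Above-hole l b ps
  ... | _ , []    | left , tt          = p ∷ left , tt
  ... | _ , _ ∷ _ | (left , right) , q = (p ∷ left , right) , q

  AboveHead-hole : ∀ l {a r} bs → AboveHead (l ++ a ∷ r) bs → HoleAbove l r bs × AboveHole a l bs
  AboveHead-hole l []      _ = tt , tt
  AboveHead-hole l (b ∷ _) p = Above-hole l b p

  hole-left-[] : ∀ l x r b bs {bl} → splitAt (length l) b ≡ (bl , []) → Above l bl →
                 HoleAbove (l ++ x ∷ []) r (b ∷ bs) × AboveHole x (l ++ x ∷ []) (b ∷ bs)
  hole-left-[] l x r b bs eq left
    rewrite length-∷ʳ l {x} | splitAt-suc-[] (length l) b eq = left ++ᵖ (x ∷ []) , tt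

  hole-left-∷ : ∀ l x r b bs {bl y br} → splitAt (length l) b ≡ (bl , y ∷ br) →
                Pointwise _≥ᵛ_ bl l → Above (x ∷ r) br → x ≤ᵛ y →
                HoleAbove (l ++ x ∷ []) r (b ∷ bs) × AboveHole x (l ++ x ∷ []) (b ∷ bs)
  hole-left-∷ l x r b bs {br = br} eq left right x≤y
    rewrite length-∷ʳ l {x} | splitAt-suc-∷ (length l) b eq with br | right
  ... | []    | []       = fromPointwise (Pointwise.++⁺ left (x≤y ∷ [])) , tt
  ... | _ ∷ _ | p ∷ ps   = (Pointwise.++⁺ left (x≤y ∷ []) , ps) , p

  slide-Above : ∀ l r bs {Ul u Ur} → AllPairs _≤ʰ_ (Ul ++ u ∷ Ur) → Pointwise _≥ᵛ_ l Ul →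
                Above Ur r → HoleAbove l r bs → AboveHole u l bs →
                AboveHead (Ul ++ u ∷ Ur) (slide l r bs)
  slide-Above-left : ∀ l x r b bs {Ul u u₂ Ur} → AllPairs _≤ʰ_ (Ul ++ u ∷ u₂ ∷ Ur) →
                     Pointwise _≥ᵛ_ l Ul → u₂ ≤ᵛ x → Above Ur r →
                     HoleAbove (l ++ x ∷ []) r (b ∷ bs) → AboveHole x (l ++ x ∷ []) (b ∷ bs) →
                     AboveHead (Ul ++ u ∷ u₂ ∷ Ur) (slide (l ++ x ∷ []) r (b ∷ bs))

  slide-Above l r [] {Ul} U-sorted left right _ _
    with u≤Ur ∷ Ur-sorted ← AllPairs-++⁻ʳ Ul U-sorted =
    Prefix.++⁺ left (Above-shift u≤Ur Ur-sorted right)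
  slide-Above l [] (b ∷ bs) {Ul} {u} {Ur} _ left _ hole u≤hole with splitAt (length l) b
  ... | _ , []    = fromPointwise left ++ᵖ (u ∷ Ur)
  ... | _ , _ ∷ _ = Prefix.++⁺ left (u≤hole ∷ [])
  slide-Above l (x ∷ r) (b ∷ bs) U-sorted left (u₂≤x ∷ right) hole u≤hole
    with splitAt (length l) b in eq
  ... | _ , [] = uncurry (slide-Above-left l x r b bs U-sorted left u₂≤x right)
                   (hole-left-[] l x r b bs eq hole)
  ... | _ , y ∷ _ with xMoves x y | xMoves-reflects x y
  ...   | true  | ofʸ x≤y = uncurry (slide-Above-left l x r b bs U-sorted left u₂≤x right)
                              (hole-left-∷ l x r b bs eq (proj₁ hole) (proj₂ hole) x≤y)
  ...   | false | ofⁿ _   = Prefix.++⁺ left (u≤hole ∷ u₂≤x ∷ right)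

  slide-Above-left l x r b bs {Ul} {u} {u₂} {Ur} U-sorted left u₂≤x right hole x≤hole =
    subst (λ U → AboveHead U (slide (l ++ x ∷ []) r (b ∷ bs))) (++-assoc Ul (u ∷ []) (u₂ ∷ Ur))
      (slide-Above (l ++ x ∷ []) r (b ∷ bs)
        (subst-∷-++ (AllPairs _) Ul U-sorted)
        (Pointwise.++⁺ left (≤ʰ-≤ᵛ⇒≤ᵛ u≤u₂ u₂≤x ∷ []))
        right hole (AboveHole-≤ᵛ (l ++ x ∷ []) (b ∷ bs) u₂≤x x≤hole))
    where
    u≤u₂ : u ≤ʰ u₂
    u≤u₂ with _ , u≤u₂ ∷ _ , _ ← AllPairs-middle Ul U-sorted = u≤u₂

  slide-Tableau : ∀ {i} l r bs → AllPairs _≤ʰ_ (l ++ r) → All (Symplectic i) (l ++ r) →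
                  HoleAbove l r bs → Tableau (suc i) bs → Tableau i (slide l r bs)
  slide-Tableau-∷ : ∀ {i} l r b bs → AllPairs _≤ʰ_ (l ++ r) → All (Symplectic i) (l ++ r) →
                    HoleAbove l r (b ∷ bs) → Tableau (suc i) (b ∷ bs) →
                    Tableau i (slide l r (b ∷ bs))
  slide-Tableau-up : ∀ {i} l r bl y br bs → AllPairs _≤ʰ_ (l ++ r) → All (Symplectic i) (l ++ r) →
                     Pointwise _≥ᵛ_ bl l → Above r br → All (y ≤ʰ_) r →
                     Tableau (suc i) ((bl ++ y ∷ br) ∷ bs) →
                     Tableau i ((l ++ y ∷ r) ∷ slide bl br bs)

  slide-Tableau l r []       sorted sympl _ [] = row sorted sympl tt []
  slide-Tableau l r (b ∷ bs) = slide-Tableau-∷ l r b bs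

  slide-Tableau-∷ l [] b bs sorted sympl hole tab with splitAt (length l) b in eq
  ... | bl , [] =
    row (subst (AllPairs _≤ʰ_) (++-identityʳ l) sorted) (subst (All _) (++-identityʳ l) sympl)
        (subst (Above l) (trans (sym (++-identityʳ bl)) (splitAt-++ _ b eq)) hole) tab
  ... | bl , y ∷ br =
    slide-Tableau-up l [] bl y br bs sorted sympl (proj₁ hole) (proj₂ hole) []
      (subst (λ b → Tableau _ (b ∷ bs)) (sym (splitAt-++ _ b eq)) tab)
  slide-Tableau-∷ l (x ∷ r) b bs sorted sympl hole tab with splitAt (length l) b in eq
  ... | bl , [] =
    slide-Tableau-∷ (l ++ x ∷ []) r b bs
      (subst-∷-++ (AllPairs _) l sorted) (subst-∷-++ (All _) l sympl)
      (proj₁ (hole-left-[] l x r b bs eq hole)) tab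
  ... | bl , y ∷ br with xMoves x y | xMoves-reflects x y
  ...   | true | ofʸ x≤y =
    slide-Tableau-∷ (l ++ x ∷ []) r b bs
      (subst-∷-++ (AllPairs _) l sorted) (subst-∷-++ (All _) l sympl)
      (proj₁ (hole-left-∷ l x r b bs eq (proj₁ hole) (proj₂ hole) x≤y)) tab
  ...   | false | ofⁿ x≰y =
    slide-Tableau-up l (x ∷ r) bl y br bs sorted sympl (proj₁ hole) (proj₂ hole)
      (y≤x ∷ All.map (≤ʰ-trans y≤x) (proj₁ (proj₂ (AllPairs-middle l sorted))))
      (subst (λ b → Tableau _ (b ∷ bs)) (sym (splitAt-++ _ b eq)) tab)
    where y≤x = ≰ᵛ⇒≥ʰ x≰y

  slide-Tableau-up l r bl y br bs sorted sympl left right y≤r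
                   (row b-sorted b-sympl b-above bs-tab) =
    let bl≤y , _ , b⁻-sorted = AllPairs-middle bl b-sorted
        y-sympl , b⁻-sympl   = All-middle bl b-sympl
        hole , y≤hole        = AboveHead-hole bl bs b-above
        l⟨y⟩r-sorted         = AllPairs-insert l (Pointwise-All-≤ʰ left bl≤y) y≤r sorted
    in row l⟨y⟩r-sorted (All-insert l (Symplectic-pred y y-sympl) sympl)
           (slide-Above bl br bs l⟨y⟩r-sorted left right hole y≤hole)
           (slide-Tableau bl br bs b⁻-sorted b⁻-sympl hole bs-tab)

  data AboveSplit (l : Row) (a : Letter m n) (r : Row) : Row → Set where
    split : ∀ {Ul u Ur} → Pointwise _≥ᵛ_ l Ul → u ≤ᵛ a → Above Ur r →
            AboveSplit l a r (Ul ++ u ∷ Ur)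

  Above-split : ∀ l {a r U} → Above U (l ++ a ∷ r) → AboveSplit l a r U
  Above-split []      (p ∷ ps) = split [] p ps
  Above-split (_ ∷ l) (p ∷ ps) with Above-split l ps
  ... | split left q right = split (p ∷ left) q right

  -- The cancelled letter a was never placed, but it still mediates between
  -- the entry above the hole and the one below it.
  slide-Above-cancel : ∀ l r bs {U a} → AllPairs _≤ʰ_ U → Above U (l ++ a ∷ r) →
                       HoleAbove l r bs → AboveHole a l bs → AboveHead U (slide l r bs)
  slide-Above-cancel l r bs U-sorted above hole a≤hole with Above-split l above
  ... | split left u≤a right =
    slide-Above l r bs U-sorted left right hole (AboveHole-≤ᵛ l bs u≤a a≤hole)

  AboveHead-∷ʳ : ∀ w {x} ws → AboveHead w ws → AboveHead (w ++ x ∷ []) ws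
  AboveHead-∷ʳ w []      _ = tt
  AboveHead-∷ʳ w (_ ∷ _) p = p ++ᵖ _

  insRows-Above : ∀ {i} z rows l {z₀ r} → Tableau i rows → AboveHead (l ++ z ∷ r) rows →
                  All (_≤ʰ z₀) l → z₀ ≤ᵛ z → AllPairs _≤ʰ_ (l ++ z₀ ∷ r) →
                  AboveHead (l ++ z₀ ∷ r) (insRows i z rows)
  insRows-Above z [] l _ _ l≤z₀ z₀≤z _ = Above-bump-append l [] [] [] l≤z₀ z₀≤z
  insRows-Above {i} z (w ∷ ws) l (row _ _ w-above _) above l≤z₀ z₀≤z U-sorted
    with findBump z w | bumpView z w
  ... | nothing | append w≤z = Above-bump-append l w above w≤z l≤z₀ z₀≤z
  ... | just (pre , z′ , post) | bump .pre .z′ .post pre≤z z≤z′ with cancel i z z′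
  ...   | false = Above-bump-replace l pre above pre≤z z≤z′ l≤z₀ z₀≤z
  ...   | true  =
    slide-Above-cancel pre post ws U-sorted (Above-bump-replace l pre above pre≤z z≤z′ l≤z₀ z₀≤z)
      (proj₁ hole) (AboveHole-≤ᵛ pre ws z≤z′ (proj₂ hole))
    where hole = AboveHead-hole pre ws w-above

  insRows-Tableau : ∀ {i} z rows → Tableau i rows → Symplectic i z → Tableau i (insRows i z rows)
  insRows-Tableau z [] [] z-sympl = row ([] ∷ []) (z-sympl ∷ []) tt []
  insRows-Tableau {i} z (w ∷ ws) (row sorted sympl above tab) z-sympl
    with findBump z w | bumpView z w
  ... | nothing | append w≤z =
    row (AllPairs.++⁺ sorted ([] ∷ []) (All.map (_∷ []) w≤z)) (++⁺ sympl (z-sympl ∷ []))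
        (AboveHead-∷ʳ w ws above) tab
  ... | just (pre , z′ , post) | bump .pre .z′ .post pre≤z z≤z′
    with AllPairs-middle pre sorted | All-middle pre sympl | cancel i z z′ in cancelled
  ...   | _ , _ , sorted⁻ | _ , sympl⁻ | true =
    slide-Tableau pre post ws sorted⁻ sympl⁻ (proj₁ (AboveHead-hole pre ws above)) tab
  ...   | _ , z′≤post , sorted⁻ | _ , sympl⁻ | false =
    row sorted′ (All-insert pre z-sympl sympl⁻)
        (insRows-Above z′ ws pre tab above pre≤z z≤z′ sorted′)
        (insRows-Tableau z′ ws tab (bumped-symplectic z z′ z-sympl z≤z′ cancelled))
    where sorted′ = AllPairs-insert pre pre≤z (All.map (≤ᵛ-≤ʰ⇒≤ʰ z≤z′) z′≤post) sorted⁻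

lemma3p1 : {m n : ℕ} (T : List (List (Letter m n))) (b : Letter m n) →
           IsSpoTableau T → IsSpoTableau (spoInsert T b)
lemma3p1 T b t =
  Tableau⇒IsSpoTableau (insRows-Tableau b T (IsSpoTableau⇒Tableau t) (Symplectic-zero b))
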